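{- Let $G$ be an $\{\mathrm{ISK4},\mathrm{wheel}\}$-free trigraph. Then $G$ admits a clique-cutset or a stable 2-cutset if and only if $G$ admits a good cut-partition.
   Context: A trigraph $G$ consists of a finite set $V(G)$ and a function $\theta_G:\binom{V(G)}{2}\to\{ -1,0,1\}$; for distinct vertices $u,v$ write $uv$ for $\{u,v\}$. The pair $uv$ is strongly adjacent if $\theta_G(uv)=1$, semi-adjacent if $\theta_G(uv)=0$, strongly anti-adjacent if $\theta_G(uv)=-1$; $u,v$ are adjacent if $\theta_G(uv)\ge0$ and anti-adjacent if $\theta_G(uv)\le 0$. A realization of $G$ is any graph on $V(G)$ obtained by turning each semi-adjacent pair into an edge or a non-edge (strongly adjacent pairs being edges, strongly anti-adjacent pairs non-edges); the full realization turns all semi-adjacent pairs into edges. $G[X]$ is the induced subtrigraph on $X$ and $G\setminus X=G[V(G)\setminus X]$. $G$ is connected if its full realization is connected. An ISK4 is a graph isomorphic to a subdivision of $K_4$; a wheel is a graph consisting of a chordless cycle plus a vertex with at least three neighbors on the cycle; $G$ is $\{\mathrm{ISK4},\mathrm{wheel}\}$-free if no realization of $G$ has an induced subgraph that is an ISK4 or a wheel. A stable set (strong clique) is a set of pairwise anti-adjacent (strongly adjacent) vertices. A clique-cutset is a (possibly empty) strong clique $C$ with $G\setminus C$ disconnected. A stable 2-cutset is a stable set $C$ of size two with $G\setminus C$ disconnected. A cut-partition of $G$ is a partition $(A,B,C)$ of $V(G)$ with $A,B$ non-empty such that every vertex of $A$ is strongly anti-adjacent to every vertex of $B$. A narrow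 path between $a$ and $b$ is an induced subtrigraph whose full realization is a path with endpoints $a,b$. A good cut-partition is a cut-partition $(A,B,C)$ such that either $C$ is a clique-cutset with $|C|\le 3$ (type clique), or $C$ is a stable 2-cutset and each of $G[A\cup C]$ and $G[B\cup C]$ contains a narrow path between the two vertices of $C$ (type stable). -}

module Defs where

open import Data.Nat using (ℕ; zero; suc; _+_; _≤_)
open import Data.Fin using (Fin; toℕ; fromℕ)
import Data.Fin as Fin
open import Data.Fin.Subset using (Subset; _∈_; _∉_; ∁; ∣_∣; Nonempty)
open import Data.Vec using (tabulate)
open import Data.Bool using (Bool; true; false)
open import Data.Sum using (_⊎_)
open import Data.Product using (Σ; ∃; ∃-syntax; _×_)
open import Data.Unit using (⊤)
open import Data.Empty using (⊥)
open import Relation.Nullary using (¬_)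
open import Relation.Binary.PropositionalEquality using (_≡_; _≢_)

data Tri : Set where
  neg zer pos : Tri

record Trigraph (n : ℕ) : Set where
  field
    θ     : Fin n → Fin n → Tri
    θ-sym : ∀ u v → θ u v ≡ θ v u
  -- values on the diagonal θ v v are irrelevant and never used

open Trigraph public

module _ {n : ℕ} (G : Trigraph n) where

  StronglyAdjacent StronglyAntiAdjacent Adjacent AntiAdjacent : Fin n → Fin n → Set
  StronglyAdjacent u v     = θ G u v ≡ pos
  StronglyAntiAdjacent u v = θ G u v ≡ neg
  Adjacent u v             = θ G u v ≢ neg   -- θ ≥ 0; also adjacency in the full realization
  AntiAdjacent u v         = θ G u v ≢ pos

  record Realization : Set where
    field
      E      : Fin n → Fin n → Bool
      E-sym  : ∀ u v → E u v ≡ E v u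
      E-pos  : ∀ u v → u ≢ v → θ G u v ≡ pos → E u v ≡ true
      E-neg  : ∀ u v → u ≢ v → θ G u v ≡ neg → E u v ≡ false

  StrongClique : Subset n → Set
  StrongClique C = ∀ u v → u ∈ C → v ∈ C → u ≢ v → StronglyAdjacent u v

  StableSet : Subset n → Set
  StableSet C = ∀ u v → u ∈ C → v ∈ C → u ≢ v → AntiAdjacent u v

  -- G[X] is disconnected: its (full realization's) vertex set splits into two
  -- nonempty disjoint parts with no edge of the full realization between them,
  -- i.e. every cross pair is strongly anti-adjacent.
  Disconnected : Subset n → Set
  Disconnected X = ∃[ Y ] ∃[ Z ]
      Nonempty Y × Nonempty Z
    × (∀ v → v ∈ Y → v ∈ X) × (∀ v → v ∈ Z → v ∈ X)
    × (∀ v → v ∈ X → v ∈ Y ⊎ v ∈ Z)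
    × (∀ v → v ∈ Y → v ∈ Z → ⊥)
    × (∀ y z → y ∈ Y → z ∈ Z → StronglyAntiAdjacent y z)

  CliqueCutset : Subset n → Set
  CliqueCutset C = StrongClique C × Disconnected (∁ C)

  Stable2Cutset : Subset n → Set
  Stable2Cutset C = StableSet C × ∣ C ∣ ≡ 2 × Disconnected (∁ C)

record InducedCopy {n : ℕ} (V : Set) (Adj : V → V → Set)
                   (H : Fin n → Fin n → Set) : Set where
  field
    f     : V → Fin n
    f-inj : ∀ x y → f x ≡ f y → x ≡ y
    f-adj : ∀ x y → x ≢ y → (H (f x) (f y) → Adj x y) × (Adj x y → H (f x) (f y))

f0 f1 f2 f3 : Fin 4
f0 = Fin.zero
f1 = Fin.suc Fin.zero
f2 = Fin.suc (Fin.suc Fin.zero)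
f3 = Fin.suc (Fin.suc (Fin.suc Fin.zero))

-- The six edges of K4 on branch vertices Fin 4 are indexed by Fin 6;
-- edge e joins end₁ e and end₂ e.  l e is the number of internal
-- (subdivision) vertices on the path replacing edge e.

end₁ end₂ : Fin 6 → Fin 4
end₁ e with toℕ e
... | 0 = f0
... | 1 = f0
... | 2 = f0
... | 3 = f1
... | 4 = f1
... | _ = f2
end₂ e with toℕ e
... | 0 = f1
... | 1 = f2
... | 2 = f3
... | 3 = f2
... | 4 = f3
... | _ = f3

data K4Vertex (l : Fin 6 → ℕ) : Set where
  branch : Fin 4 → K4Vertex l
  inner  : (e : Fin 6) → Fin (l e) → K4Vertex l

data OnPath (l : Fin 6 → ℕ) (e : Fin 6) : K4Vertex l → ℕ → Set where
  at-end₁  : OnPath l e (branch (end₁ e)) 0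
  at-end₂  : OnPath l e (branch (end₂ e)) (suc (l e))
  at-inner : (t : Fin (l e)) → OnPath l e (inner e t) (suc (toℕ t))

K4Adj : (l : Fin 6 → ℕ) → K4Vertex l → K4Vertex l → Set
K4Adj l x y = ∃[ e ] ∃[ p ] ∃[ q ]
  OnPath l e x p × OnPath l e y q × (suc p ≡ q ⊎ suc q ≡ p)

-- Wheels: a chordless cycle of length k ≥ 3 (vertices Fin k, i ~ i±1 mod k)
-- plus a center adjacent to the cycle vertices in S, with ≥ 3 such.

CycleAdj : (k : ℕ) → Fin k → Fin k → Set
CycleAdj k i j =
    suc (toℕ i) ≡ toℕ j ⊎ suc (toℕ j) ≡ toℕ i
  ⊎ (toℕ i ≡ 0 × suc (toℕ j) ≡ k) ⊎ (toℕ j ≡ 0 × suc (toℕ i) ≡ k)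

data WheelVertex (k : ℕ) : Set where
  rim    : Fin k → WheelVertex k
  center : WheelVertex k

WheelAdj : (k : ℕ) → (Fin k → Bool) → WheelVertex k → WheelVertex k → Set
WheelAdj k S (rim i) (rim j) = CycleAdj k i j
WheelAdj k S (rim i) center  = S i ≡ true
WheelAdj k S center  (rim j) = S j ≡ true
WheelAdj k S center  center  = ⊥

AtLeastThree : {k : ℕ} → (Fin k → Bool) → Set
AtLeastThree {k} S = ∃[ a ] ∃[ b ] ∃[ c ]
  a ≢ b × a ≢ c × b ≢ c × S a ≡ true × S b ≡ true × S c ≡ true

module _ {n : ℕ} {G : Trigraph n} (R : Realization G) where
  open Realization R

  RAdj : Fin n → Fin n → Set
  RAdj u v = E u v ≡ true

  HasISK4 : Set
  HasISK4 = ∃[ l ] InducedCopy (K4Vertex l) (K4Adj l) RAdj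

  HasWheel : Set
  HasWheel = ∃[ k ] 3 ≤ k × ∃[ S ] AtLeastThree S
             × InducedCopy (WheelVertex k) (WheelAdj k S) RAdj

ISK4WheelFree : {n : ℕ} → Trigraph n → Set
ISK4WheelFree G = ∀ (R : Realization G) → ¬ HasISK4 R × ¬ HasWheel R

-- Cut-partitions, described by a labelling of vertices into A, B, C

data Part : Set where
  inA inB inC : Part

module _ {n : ℕ} (G : Trigraph n) where

  partSet : (Fin n → Part) → Part → Subset n
  partSet lab P = tabulate λ v → isP (lab v) P
    where
      isP : Part → Part → Bool
      isP inA inA = true
      isP inB inB = true
      isP inC inC = true
      isP _   _   = false

  IsCutPartition : (Fin n → Part) → Set
  IsCutPartition lab =
      (∃[ a ] lab a ≡ inA) × (∃[ b ] lab b ≡ inB)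
    × (∀ a b → lab a ≡ inA → lab b ≡ inB → StronglyAntiAdjacent G a b)

  -- A narrow path between a and b inside the vertex set X: an induced
  -- subtrigraph whose full realization is a path p₀ … p_k with p₀ = a, p_k = b.
  PathAdj : (k : ℕ) → Fin (suc k) → Fin (suc k) → Set
  PathAdj k i j = suc (toℕ i) ≡ toℕ j ⊎ suc (toℕ j) ≡ toℕ i

  NarrowPathIn : Subset n → Fin n → Fin n → Set
  NarrowPathIn X a b = ∃[ k ] Σ (InducedCopy (Fin (suc k)) (PathAdj k) (Adjacent G)) λ P →
      let p = InducedCopy.f P in
      p Fin.zero ≡ a × p (fromℕ k) ≡ b × (∀ i → p i ∈ X)

  GoodCutPartition : Set
  GoodCutPartition = ∃[ lab ] IsCutPartition lab ×
    ( (CliqueCutset G (partSet lab inC) × ∣ partSet lab inC ∣ ≤ 3)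
    ⊎ (Stable2Cutset G (partSet lab inC)
       × ∃[ u ] ∃[ v ] u ∈ partSet lab inC × v ∈ partSet lab inC × u ≢ v
       × NarrowPathIn (∁ (partSet lab inB)) u v
       × NarrowPathIn (∁ (partSet lab inA)) u v))

-- A good cut-partition carries its cutset, so only the forward direction needs an argument.
-- A clique-cutset C separating y from z gives the cut-partition (side of y, rest, C), which is good
-- because |C| ≤ 3: four pairwise strongly adjacent vertices induce a K4 in the full realization.
-- For a stable 2-cutset {a, b} let S be the component of y and T a component of the rest.  If one
-- of a, b, say a, has no neighbour in S (or in T), then {b} alone is a clique-cutset separating
-- that component from a.  Otherwise a and b have neighbours in both S and T, so walks a - S - b
-- and a - T - b exist; shortcutting them yields the two narrow paths, and ({a, b}, S, the rest)
-- is good of type stable.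
module Submission where

open import Defs
open import Data.Nat using (ℕ; zero; suc; _+_; _≤_; s≤s; _≤?_)
open import Data.Nat.Properties
  using (≤-reflexive; ≤-pred; <-irrefl; ≰⇒>; m≤m+n; suc-injective; module ≤-Reasoning)
open import Data.Fin using (Fin; fromℕ; #_; _≟_) renaming (zero to fzero; suc to fsuc)
import Data.Fin.Properties as Fin
open import Data.Fin.Subset
  using (Subset; inside; outside; _∈_; _∉_; _⊆_; _⊃_; ∁; _∪_; ⁅_⁆; _-_; ∣_∣)
open import Data.Fin.Subset.Properties
  using ( _∈?_; x∈p∪q⁺; x∈p∪q⁻; p⊆p∪q; x∈⁅x⁆; x∈⁅y⁆⇒x≡y; x≢y⇒x∉⁅y⁆; x∈∁p⇒x∉p; x∉p⇒x∈∁p; x∉∁p⇒x∈p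
        ; ⊆-antisym; x∈p∧x≢y⇒x∈p-y; x∈p⇒∣p-x∣<∣p∣)
open import Data.Fin.Subset.Induction using (⊃-wellFounded)
open import Data.Vec as Vec using (_∷_; here; there)
open import Data.Vec.Properties using (lookup∘tabulate; lookup⇒[]=; []=⇒lookup)
open import Data.List using (List; []; _∷_; length; lookup)
open import Data.List.Relation.Unary.All as All using (All; []; _∷_)
open import Data.List.Relation.Unary.All.Properties using (¬Any⇒All¬)
open import Data.List.Membership.Propositional.Properties using (∈-lookup)
open import Data.List.Relation.Unary.Any using (Any; here; there; any?)
open import Data.Bool using (Bool; true; false)
open import Data.Product using (_×_; ∃-syntax; Σ-syntax; _,_; proj₁; proj₂)
open import Data.Sum using (_⊎_; inj₁; inj₂; [_,_])
import Data.Sum as Sum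
open import Data.Unit using (⊤; tt)
open import Data.Empty using (⊥-elim)
open import Function using (_∘_; _∋_; id)
open import Function.Definitions using (Injective)
open import Induction.WellFounded using (Acc; acc)
open import Relation.Nullary using (¬_; Dec; yes; no; ¬?)
open import Relation.Nullary.Decidable using (_×-dec_; decidable-stable)
open import Relation.Binary.PropositionalEquality using (_≡_; _≢_; refl; sym; trans; cong; subst)
open import Relation.Binary.Construct.Closure.ReflexiveTransitive using (Star; ε; _◅_; _◅◅_; revApp)
import Relation.Binary.Construct.Closure.ReflexiveTransitive as Star

injectionInto : ∀ {n} k (p : Subset n) → k ≤ ∣ p ∣ →
                Σ[ f ∈ (Fin k → Fin n) ] Injective _≡_ _≡_ f × (∀ i → f i ∈ p)
injectionInto zero    p             _  = (λ ()) , (λ { {()} }) , (λ ())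
injectionInto (suc k) (inside ∷ p)  k< with injectionInto k p (≤-pred k<)
... | f , f-injective , f∈p = g , g-injective , g∈p
  where
  g : Fin (suc k) → Fin _
  g fzero    = fzero
  g (fsuc i) = fsuc (f i)
  g-injective : Injective _≡_ _≡_ g
  g-injective {fzero}  {fzero}  _  = refl
  g-injective {fsuc i} {fsuc j} eq = cong fsuc (f-injective (Fin.suc-injective eq))
  g∈p : ∀ i → g i ∈ inside ∷ p
  g∈p fzero    = here
  g∈p (fsuc i) = there (f∈p i)
injectionInto k       (outside ∷ p) k≤ with injectionInto k p k≤
... | f , f-injective , f∈p = fsuc ∘ f , f-injective ∘ Fin.suc-injective , there ∘ f∈p

3-distinct⇒3≤∣p∣ : ∀ {n} {p : Subset n} {a b w} → a ∈ p → b ∈ p → w ∈ p →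
                   b ≢ a → w ≢ a → w ≢ b → 3 ≤ ∣ p ∣
3-distinct⇒3≤∣p∣ {p = p} {a} {b} {w} a∈p b∈p w∈p b≢a w≢a w≢b = begin
  3                      ≤⟨ m≤m+n 3 _ ⟩
  3 + ∣ p - a - b - w ∣  ≤⟨ s≤s (s≤s (x∈p⇒∣p-x∣<∣p∣ w∈p-a-b)) ⟩
  2 + ∣ p - a - b ∣      ≤⟨ s≤s (x∈p⇒∣p-x∣<∣p∣ b∈p-a) ⟩
  1 + ∣ p - a ∣          ≤⟨ x∈p⇒∣p-x∣<∣p∣ a∈p ⟩
  ∣ p ∣                  ∎
  where
  open ≤-Reasoning
  b∈p-a : b ∈ p - a
  b∈p-a = x∈p∧x≢y⇒x∈p-y b∈p b≢a
  w∈p-a-b : w ∈ p - a - b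
  w∈p-a-b = x∈p∧x≢y⇒x∈p-y (x∈p∧x≢y⇒x∈p-y w∈p w≢a) w≢b

∣p∣≡2⇒∈-pair : ∀ {n} {p : Subset n} {a b w} → ∣ p ∣ ≡ 2 → a ∈ p → b ∈ p → b ≢ a → w ∈ p →
               w ≡ a ⊎ w ≡ b
∣p∣≡2⇒∈-pair {a = a} {b} {w} size a∈p b∈p b≢a w∈p with w ≟ a
... | yes w≡a = inj₁ w≡a
... | no w≢a with w ≟ b
...   | yes w≡b = inj₂ w≡b
...   | no w≢b =
  ⊥-elim (<-irrefl refl (subst (3 ≤_) size (3-distinct⇒3≤∣p∣ a∈p b∈p w∈p b≢a w≢a w≢b)))

∣p∣≡2⇒pair : ∀ {n} {p : Subset n} → ∣ p ∣ ≡ 2 →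
             ∃[ a ] ∃[ b ] a ∈ p × b ∈ p × b ≢ a × (∀ {w} → w ∈ p → w ≡ a ⊎ w ≡ b)
∣p∣≡2⇒pair {p = p} size with injectionInto 2 p (≤-reflexive (sym size))
... | f , f-injective , f∈p =
  _ , _ , f∈p (# 0) , f∈p (# 1) , b≢a , ∣p∣≡2⇒∈-pair size (f∈p _) (f∈p _) b≢a
  where
  b≢a : f (# 1) ≢ f (# 0)
  b≢a eq with () ← f-injective eq

classify : {P Q : Set} → Dec P → Dec Q → Part
classify (yes _) _       = inC
classify (no _)  (yes _) = inA
classify (no _)  (no _)  = inB

module _ {P Q : Set} where

  classify-inC : (p? : Dec P) (q? : Dec Q) → P → classify p? q? ≡ inC
  classify-inC (yes _) _ _ = refl
  classify-inC (no ¬p) _ p = ⊥-elim (¬p p)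

  classify-inA : (p? : Dec P) (q? : Dec Q) → ¬ P → Q → classify p? q? ≡ inA
  classify-inA (yes p) _       ¬p _ = ⊥-elim (¬p p)
  classify-inA (no _)  (yes _) _  _ = refl
  classify-inA (no _)  (no ¬q) _  q = ⊥-elim (¬q q)

  classify-inB : (p? : Dec P) (q? : Dec Q) → ¬ P → ¬ Q → classify p? q? ≡ inB
  classify-inB (yes p) _       ¬p _  = ⊥-elim (¬p p)
  classify-inB (no _)  (yes q) _  ¬q = ⊥-elim (¬q q)
  classify-inB (no _)  (no _)  _  _  = refl

  classify≡inC : (p? : Dec P) (q? : Dec Q) → classify p? q? ≡ inC → P
  classify≡inC (yes p) _       _  = p
  classify≡inC (no _)  (yes _) ()
  classify≡inC (no _)  (no _)  ()

  classify≡inA : (p? : Dec P) (q? : Dec Q) → classify p? q? ≡ inA → ¬ P × Q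
  classify≡inA (yes _) _       ()
  classify≡inA (no ¬p) (yes q) _  = ¬p , q
  classify≡inA (no _)  (no _)  ()

  classify≡inB : (p? : Dec P) (q? : Dec Q) → classify p? q? ≡ inB → ¬ P × ¬ Q
  classify≡inB (yes _) _       ()
  classify≡inB (no _)  (yes _) ()
  classify≡inB (no ¬p) (no ¬q) _  = ¬p , ¬q

nonNegative : Tri → Bool
nonNegative neg = false
nonNegative zer = true
nonNegative pos = true

unsubdivided : Fin 6 → ℕ
unsubdivided _ = 0

K4Adj-sym : ∀ {l x y} → K4Adj l x y → K4Adj l y x
K4Adj-sym (e , p , q , x-at-p , y-at-q , step) = e , q , p , y-at-q , x-at-p , Sum.swap step

edge-adjacent : ∀ e → K4Adj unsubdivided (branch (end₁ e)) (branch (end₂ e))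
edge-adjacent e = e , 0 , 1 , at-end₁ , at-end₂ , inj₁ refl

branches-adjacent : ∀ i j → i ≢ j → K4Adj unsubdivided (branch i) (branch j)
branches-adjacent fzero                      fzero                      i≢j = ⊥-elim (i≢j refl)
branches-adjacent fzero                      (fsuc fzero)               _   = edge-adjacent (# 0)
branches-adjacent fzero                      (fsuc (fsuc fzero))        _   = edge-adjacent (# 1)
branches-adjacent fzero                      (fsuc (fsuc (fsuc fzero))) _   = edge-adjacent (# 2)
branches-adjacent (fsuc fzero)               fzero                      _   = K4Adj-sym (edge-adjacent (# 0))
branches-adjacent (fsuc fzero)               (fsuc fzero)               i≢j = ⊥-elim (i≢j refl)
branches-adjacent (fsuc fzero)               (fsuc (fsuc fzero))        _   = edge-adjacent (# 3)
branches-adjacent (fsuc fzero)               (fsuc (fsuc (fsuc fzero))) _   = edge-adjacent (# 4)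
branches-adjacent (fsuc (fsuc fzero))        fzero                      _   = K4Adj-sym (edge-adjacent (# 1))
branches-adjacent (fsuc (fsuc fzero))        (fsuc fzero)               _   = K4Adj-sym (edge-adjacent (# 3))
branches-adjacent (fsuc (fsuc fzero))        (fsuc (fsuc fzero))        i≢j = ⊥-elim (i≢j refl)
branches-adjacent (fsuc (fsuc fzero))        (fsuc (fsuc (fsuc fzero))) _   = edge-adjacent (# 5)
branches-adjacent (fsuc (fsuc (fsuc fzero))) fzero                      _   = K4Adj-sym (edge-adjacent (# 2))
branches-adjacent (fsuc (fsuc (fsuc fzero))) (fsuc fzero)               _   = K4Adj-sym (edge-adjacent (# 4))
branches-adjacent (fsuc (fsuc (fsuc fzero))) (fsuc (fsuc fzero))        _   = K4Adj-sym (edge-adjacent (# 5))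
branches-adjacent (fsuc (fsuc (fsuc fzero))) (fsuc (fsuc (fsuc fzero))) i≢j = ⊥-elim (i≢j refl)

module _ {n : ℕ} (G : Trigraph n) where

  -- partSet decides membership with a function local to its definition, which can only be
  -- reached through lookup∘tabulate; case analysis on the two parts then lets it compute.
  ∈-partSet⁺ : ∀ {lab : Fin n → Part} {P v} → lab v ≡ P → v ∈ partSet G lab P
  ∈-partSet⁺ {lab} {P} {v} lab≡P with (Vec.lookup (partSet G lab P) v ≡ _) ∋ lookup∘tabulate _ v
  ... | e with lab v | P | lab≡P
  ... | inA | inA | refl = lookup⇒[]= v _ e
  ... | inB | inB | refl = lookup⇒[]= v _ e
  ... | inC | inC | refl = lookup⇒[]= v _ e

  ∈-partSet⁻ : ∀ {lab : Fin n → Part} {P v} → v ∈ partSet G lab P → lab v ≡ P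
  ∈-partSet⁻ {lab} {P} {v} v∈ with trans (sym (lookup∘tabulate _ v)) ([]=⇒lookup v∈)
  ... | e with lab v | P
  ... | inA | inA = refl
  ... | inB | inB = refl
  ... | inC | inC = refl
  ... | inA | inB with () ← e
  ... | inA | inC with () ← e
  ... | inB | inA with () ← e
  ... | inB | inC with () ← e
  ... | inC | inA with () ← e
  ... | inC | inB with () ← e

  adjacent? : ∀ u v → Dec (Adjacent G u v)
  adjacent? u v with θ G u v
  ... | neg = no λ adjacent → adjacent refl
  ... | zer = yes λ ()
  ... | pos = yes λ ()

  ¬adjacent⇒stronglyAntiAdjacent : ∀ {u v} → ¬ Adjacent G u v → StronglyAntiAdjacent G u v
  ¬adjacent⇒stronglyAntiAdjacent {u} {v} ¬adjacent with θ G u v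
  ... | neg = refl
  ... | zer = ⊥-elim (¬adjacent λ ())
  ... | pos = ⊥-elim (¬adjacent λ ())

  adjacent-sym : ∀ {u v} → Adjacent G u v → Adjacent G v u
  adjacent-sym {u} {v} adjacent = adjacent ∘ trans (θ-sym G u v)

  stronglyAntiAdjacent-sym : ∀ {u v} → StronglyAntiAdjacent G u v → StronglyAntiAdjacent G v u
  stronglyAntiAdjacent-sym {u} {v} = trans (θ-sym G v u)

  fullRealization : Realization G
  fullRealization = record
    { E     = λ u v → nonNegative (θ G u v)
    ; E-sym = λ u v → cong nonNegative (θ-sym G u v)
    ; E-pos = λ u v _ → cong nonNegative
    ; E-neg = λ u v _ → cong nonNegative
    }

  strongK4⇒ISK4 : (f : Fin 4 → Fin n) → Injective _≡_ _≡_ f →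
                  (∀ i j → i ≢ j → StronglyAdjacent G (f i) (f j)) → HasISK4 fullRealization
  strongK4⇒ISK4 f f-injective strong = unsubdivided , record
    { f = embed ; f-inj = embed-injective ; f-adj = embed-adjacent }
    where
    embed : K4Vertex unsubdivided → Fin n
    embed (branch i) = f i
    embed (inner _ ())
    embed-injective : ∀ x y → embed x ≡ embed y → x ≡ y
    embed-injective (branch i) (branch j) eq = cong branch (f-injective eq)
    embed-adjacent : ∀ x y → x ≢ y →
      (RAdj fullRealization (embed x) (embed y) → K4Adj unsubdivided x y)
      × (K4Adj unsubdivided x y → RAdj fullRealization (embed x) (embed y))
    embed-adjacent (branch i) (branch j) x≢y =
        (λ _ → branches-adjacent i j (x≢y ∘ cong branch))
      , (λ _ → cong nonNegative (strong i j (x≢y ∘ cong branch)))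

  strongClique⇒∣∣≤3 : ISK4WheelFree G → ∀ {C} → StrongClique G C → ∣ C ∣ ≤ 3
  strongClique⇒∣∣≤3 free {C} clique with ∣ C ∣ ≤? 3
  ... | yes ∣C∣≤3 = ∣C∣≤3
  ... | no ∣C∣≰3 with injectionInto 4 C (≰⇒> ∣C∣≰3)
  ...   | f , f-injective , f∈C =
    ⊥-elim (proj₁ (free fullRealization) (strongK4⇒ISK4 f f-injective strong))
    where
    strong : ∀ i j → i ≢ j → StronglyAdjacent G (f i) (f j)
    strong i j i≢j = clique (f i) (f j) (f∈C i) (f∈C j) (i≢j ∘ f-injective)

  EdgeWithin : (Fin n → Set) → Fin n → Fin n → Set
  EdgeWithin Q u v = Q u × Adjacent G u v × Q v

  WalkWithin : (Fin n → Set) → Fin n → Fin n → Set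
  WalkWithin Q = Star (EdgeWithin Q)

  edgeWithin-sym : ∀ {Q u v} → EdgeWithin Q u v → EdgeWithin Q v u
  edgeWithin-sym (qu , adjacent , qv) = qv , adjacent-sym adjacent , qu

  walkWithin-mono : ∀ {Q Q′} → (∀ {w} → Q w → Q′ w) → ∀ {s t} → WalkWithin Q s t → WalkWithin Q′ s t
  walkWithin-mono Q⊆Q′ = Star.map λ (qu , adjacent , qv) → Q⊆Q′ qu , adjacent , Q⊆Q′ qv

  InducedPath : Fin n → List (Fin n) → Set
  InducedPath x []       = ⊤
  InducedPath x (y ∷ ys) =
    Adjacent G x y × All (x ≢_) (y ∷ ys) × All (StronglyAntiAdjacent G x) ys × InducedPath y ys

  endpoint : Fin n → List (Fin n) → Fin n
  endpoint x []       = x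
  endpoint x (y ∷ ys) = endpoint y ys

  record InducedPathWithin (Q : Fin n → Set) (s t : Fin n) : Set where
    constructor inducedPath
    field
      rest    : List (Fin n)
      induced : InducedPath s rest
      ends    : endpoint s rest ≡ t
      within  : All Q (s ∷ rest)

  Touches : Fin n → Fin n → Set
  Touches v w = v ≡ w ⊎ Adjacent G v w

  touches? : ∀ v w → Dec (Touches v w)
  touches? v w with v ≟ w | adjacent? v w
  ... | yes v≡w | _       = yes (inj₁ v≡w)
  ... | no _    | yes adj = yes (inj₂ adj)
  ... | no v≢w  | no ¬adj = no [ v≢w , ¬adj ]

  -- Prepending v to the suffix that starts at the last vertex equal or adjacent to v keeps a path
  -- induced; this is how walks are shortcut to narrow paths.
  LastTouch : (Fin n → Set) → Fin n → Fin n → Set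
  LastTouch Q v t = ∃[ z ] Touches v z × Σ[ P ∈ InducedPathWithin Q z t ]
                      All (¬_ ∘ Touches v) (InducedPathWithin.rest P)

  lastTouch : ∀ {Q t} v x xs → InducedPath x xs → endpoint x xs ≡ t → All Q (x ∷ xs) →
              Any (Touches v) (x ∷ xs) → LastTouch Q v t
  lastTouch v x [] _ ends qs (here touch) = x , touch , inducedPath [] tt ends qs , []
  lastTouch v x (y ∷ ys) induced@(_ , _ , _ , induced′) ends (qx ∷ qs) touches
    with any? (touches? v) (y ∷ ys)
  ... | yes later = lastTouch v y ys induced′ ends qs later
  ... | no ¬later with touches
  ...   | here touch  = x , touch , inducedPath (y ∷ ys) induced ends (qx ∷ qs) , ¬Any⇒All¬ _ ¬later
  ...   | there later = ⊥-elim (¬later later)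

  prepend : ∀ {Q v t} → Q v → LastTouch Q v t → InducedPathWithin Q v t
  prepend {v = v} qv (z , touch , P@(inducedPath zs induced ends qs) , away) with v ≟ z
  ... | yes refl = P
  ... | no v≢z   = inducedPath (z ∷ zs)
                     ( [ ⊥-elim ∘ v≢z , id ] touch
                     , v≢z ∷ All.map (λ ¬touch → ¬touch ∘ inj₁) away
                     , All.map (λ ¬touch → ¬adjacent⇒stronglyAntiAdjacent (¬touch ∘ inj₂)) away
                     , induced )
                     ends (qv ∷ qs)

  walk⇒inducedPath : ∀ {Q s t} → Q s → WalkWithin Q s t → InducedPathWithin Q s t
  walk⇒inducedPath qs ε = inducedPath [] tt refl (qs ∷ [])
  walk⇒inducedPath qs ((_ , adjacent , qj) ◅ walk) with walk⇒inducedPath qj walk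
  ... | inducedPath js induced ends within =
    prepend qs (lastTouch _ _ js induced ends within (here (inj₂ adjacent)))

  private
    Iff : Set → Set → Set
    Iff A B = (A → B) × (B → A)

  lookup-injective : ∀ {x xs} → InducedPath x xs →
                     ∀ i j → lookup (x ∷ xs) i ≡ lookup (x ∷ xs) j → i ≡ j
  lookup-injective _                      fzero    fzero    _  = refl
  lookup-injective {xs = _ ∷ _} (_ , distinct , _) fzero (fsuc j) eq =
    ⊥-elim (All.lookup distinct (∈-lookup j) eq)
  lookup-injective {xs = _ ∷ _} (_ , distinct , _) (fsuc i) fzero eq =
    ⊥-elim (All.lookup distinct (∈-lookup i) (sym eq))
  lookup-injective {xs = _ ∷ _} (_ , _ , _ , induced) (fsuc i) (fsuc j) eq =
    cong fsuc (lookup-injective induced i j eq)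

  head-adjacent : ∀ {x y ys} → InducedPath x (y ∷ ys) → ∀ j →
                  Iff (Adjacent G x (lookup (y ∷ ys) j)) (PathAdj G (suc (length ys)) fzero (fsuc j))
  head-adjacent (adjacent , _)    fzero    = (λ _ → inj₁ refl) , (λ _ → adjacent)
  head-adjacent (_ , _ , apart , _) (fsuc j) =
      (λ adjacent → ⊥-elim (adjacent (All.lookup apart (∈-lookup j))))
    , λ { (inj₁ ()) ; (inj₂ ()) }

  lookup-adjacent : ∀ {x xs} → InducedPath x xs → ∀ i j → i ≢ j →
                    Iff (Adjacent G (lookup (x ∷ xs) i) (lookup (x ∷ xs) j)) (PathAdj G (length xs) i j)
  lookup-adjacent _ fzero fzero i≢j = ⊥-elim (i≢j refl)
  lookup-adjacent {xs = _ ∷ _} induced fzero (fsuc j) _ = head-adjacent induced j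
  lookup-adjacent {xs = _ ∷ _} induced (fsuc i) fzero _ with head-adjacent induced i
  ... | to , from = Sum.swap ∘ to ∘ adjacent-sym , adjacent-sym ∘ from ∘ Sum.swap
  lookup-adjacent {xs = _ ∷ _} (_ , _ , _ , induced) (fsuc i) (fsuc j) i≢j
    with lookup-adjacent induced i j (i≢j ∘ cong fsuc)
  ... | to , from = Sum.map (cong suc) (cong suc) ∘ to , from ∘ Sum.map suc-injective suc-injective

  lookup-endpoint : ∀ x xs → lookup (x ∷ xs) (fromℕ (length xs)) ≡ endpoint x xs
  lookup-endpoint x []       = refl
  lookup-endpoint x (y ∷ ys) = lookup-endpoint y ys

  inducedPath⇒narrow : ∀ {Q X s t} → (∀ {w} → Q w → w ∈ X) → InducedPathWithin Q s t →
                       NarrowPathIn G X s t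
  inducedPath⇒narrow {s = s} Q⊆X (inducedPath xs induced ends within) =
      length xs
    , record
        { f = lookup (s ∷ xs) ; f-inj = lookup-injective induced ; f-adj = lookup-adjacent induced }
    , refl
    , trans (lookup-endpoint s xs) ends
    , λ i → Q⊆X (All.lookup within (∈-lookup i))

  record Component (X : Subset n) (y : Fin n) : Set where
    field
      members : Subset n
      root    : y ∈ members
      ⊆X      : members ⊆ X
      walk    : ∀ {v} → v ∈ members → WalkWithin (_∈ members) y v
      closed  : ∀ {u v} → u ∈ members → v ∈ X → Adjacent G u v → v ∈ members

    connecting : ∀ {u v} → u ∈ members → v ∈ members → WalkWithin (_∈ members) u v
    connecting u∈ v∈ = revApp edgeWithin-sym (walk u∈) (walk v∈)

  component : ∀ X {y} → y ∈ X → Component X y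
  component X {y} y∈X = grow ⁅ y ⁆ (⊃-wellFounded ⁅ y ⁆) (x∈⁅x⁆ y) singleton⊆X singleton-walk
    where
    singleton⊆X : ⁅ y ⁆ ⊆ X
    singleton⊆X w∈⁅y⁆ with refl ← x∈⁅y⁆⇒x≡y y w∈⁅y⁆ = y∈X
    singleton-walk : ∀ {v} → v ∈ ⁅ y ⁆ → WalkWithin (_∈ ⁅ y ⁆) y v
    singleton-walk v∈⁅y⁆ with refl ← x∈⁅y⁆⇒x≡y y v∈⁅y⁆ = ε

    grow : ∀ S → Acc _⊃_ S → y ∈ S → S ⊆ X → (∀ {v} → v ∈ S → WalkWithin (_∈ S) y v) → Component X y
    grow S (acc larger) y∈S S⊆X walk
      with Fin.any? (λ u → Fin.any? (λ v →
             (u ∈? S) ×-dec ¬? (v ∈? S) ×-dec (v ∈? X) ×-dec adjacent? u v))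
    ... | no ¬leaving =
      record { members = S ; root = y∈S ; ⊆X = S⊆X ; walk = walk ; closed = closed }
      where
      closed : ∀ {u v} → u ∈ S → v ∈ X → Adjacent G u v → v ∈ S
      closed {u} {v} u∈S v∈X adjacent =
        decidable-stable (v ∈? S) λ v∉S → ¬leaving (u , v , u∈S , v∉S , v∈X , adjacent)
    ... | yes (u , v , u∈S , v∉S , v∈X , adjacent) =
      grow S′ (larger (S⊆S′ , v , v∈S′ , v∉S)) (S⊆S′ y∈S) S′⊆X walk′
      where
      S′ = S ∪ ⁅ v ⁆
      S⊆S′ : S ⊆ S′
      S⊆S′ = p⊆p∪q ⁅ v ⁆
      v∈S′ : v ∈ S′
      v∈S′ = x∈p∪q⁺ (inj₂ (x∈⁅x⁆ v))
      S′⊆X : S′ ⊆ X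
      S′⊆X w∈S′ with x∈p∪q⁻ S ⁅ v ⁆ w∈S′
      ... | inj₁ w∈S   = S⊆X w∈S
      ... | inj₂ w∈⁅v⁆ with refl ← x∈⁅y⁆⇒x≡y v w∈⁅v⁆ = v∈X
      walk′ : ∀ {w} → w ∈ S′ → WalkWithin (_∈ S′) y w
      walk′ w∈S′ with x∈p∪q⁻ S ⁅ v ⁆ w∈S′
      ... | inj₁ w∈S   = walkWithin-mono S⊆S′ (walk w∈S)
      ... | inj₂ w∈⁅v⁆ with refl ← x∈⁅y⁆⇒x≡y v w∈⁅v⁆ =
        walkWithin-mono S⊆S′ (walk u∈S) ◅◅ (S⊆S′ u∈S , adjacent , v∈S′) ◅ ε

  cutPartition⇒disconnected : ∀ {lab} → IsCutPartition G lab →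
                              Disconnected G (∁ (partSet G lab inC))
  cutPartition⇒disconnected {lab} ((a , a∈A) , (b , b∈B) , cross) =
      partSet G lab inA , partSet G lab inB
    , (a , ∈-partSet⁺ a∈A) , (b , ∈-partSet⁺ b∈B)
    , (λ _ → x∉p⇒x∈∁p ∘ apart (λ ()))
    , (λ _ → x∉p⇒x∈∁p ∘ apart (λ ()))
    , cover
    , (λ _ → apart (λ ()))
    , (λ u w u∈A w∈B → cross u w (∈-partSet⁻ u∈A) (∈-partSet⁻ w∈B))
    where
    apart : ∀ {P P′ v} → P ≢ P′ → v ∈ partSet G lab P → v ∉ partSet G lab P′
    apart P≢P′ v∈P v∈P′ = P≢P′ (trans (sym (∈-partSet⁻ v∈P)) (∈-partSet⁻ v∈P′))
    cover : ∀ v → v ∈ ∁ (partSet G lab inC) → v ∈ partSet G lab inA ⊎ v ∈ partSet G lab inB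
    cover v v∉C with lab v in eq
    ... | inA = inj₁ (∈-partSet⁺ eq)
    ... | inB = inj₂ (∈-partSet⁺ eq)
    ... | inC = ⊥-elim (x∈∁p⇒x∉p v∉C (∈-partSet⁺ eq))

  SeparatedBy : Subset n → Subset n → Set
  SeparatedBy D S = ∀ {u w} → u ∈ S → w ∉ S → w ∉ D → StronglyAntiAdjacent G u w

  record Separation (D : Subset n) : Set where
    field
      side       : Subset n
      separated  : SeparatedBy D side
      disjoint   : ∀ {v} → v ∈ side → v ∉ D
      near       : Fin n
      near∈side  : near ∈ side
      far        : Fin n
      far∉side   : far ∉ side
      far∉D      : far ∉ D

    labelling : Fin n → Part
    labelling v = classify (v ∈? D) (v ∈? side)

    isCutPartition : IsCutPartition G labelling
    isCutPartition =
        (near , classify-inA (near ∈? D) _ (disjoint near∈side) near∈side)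
      , (far , classify-inB _ (far ∈? side) far∉D far∉side)
      , λ u w u∈A w∈B →
          let (w∉D , w∉side) = classify≡inB (w ∈? D) _ w∈B
          in  separated (proj₂ (classify≡inA (u ∈? D) _ u∈A)) w∉side w∉D

    labelledC≡D : partSet G labelling inC ≡ D
    labelledC≡D = ⊆-antisym (λ {v} → classify≡inC (v ∈? D) _ ∘ ∈-partSet⁻)
                            (λ {v} → ∈-partSet⁺ ∘ classify-inC (v ∈? D) _)

  disconnected⇒separation : ∀ {C} → Disconnected G (∁ C) → Separation C
  disconnected⇒separation
    (Y , Z , (y , y∈Y) , (z , z∈Z) , Y⊆∁C , Z⊆∁C , cover , disjoint , cross) = record
    { side       = Y
    ; separated  = λ {u} {w} u∈Y w∉Y w∉C →
        [ ⊥-elim ∘ w∉Y , cross u w u∈Y ] (cover w (x∉p⇒x∈∁p w∉C))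
    ; disjoint   = λ {v} → x∈∁p⇒x∉p ∘ Y⊆∁C v
    ; near       = y
    ; near∈side  = y∈Y
    ; far        = z
    ; far∉side   = λ z∈Y → disjoint z z∈Y z∈Z
    ; far∉D      = x∈∁p⇒x∉p (Z⊆∁C z z∈Z)
    }

  complement-separated : ∀ {D S} → SeparatedBy D S → SeparatedBy D (∁ (D ∪ S))
  complement-separated {D} {S} separated {u} {w} u∈rest w∉rest w∉D =
    stronglyAntiAdjacent-sym (separated w∈S (u∉D∪S ∘ inj₂) (u∉D∪S ∘ inj₁))
    where
    u∉D∪S : ¬ (u ∈ D ⊎ u ∈ S)
    u∉D∪S = x∈∁p⇒x∉p u∈rest ∘ x∈p∪q⁺
    w∈S : w ∈ S
    w∈S = [ ⊥-elim ∘ w∉D , id ] (x∈p∪q⁻ D S (x∉∁p⇒x∈p w∉rest))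

  opposite : ∀ {D} → Separation D → Separation D
  opposite {D} σ = record
    { side = ∁ (D ∪ side) ; separated = complement-separated separated
    ; disjoint = λ v∈rest → rest∌ v∈rest ∘ inj₁
    ; near = far ; near∈side = x∉p⇒x∈∁p ([ far∉D , far∉side ] ∘ x∈p∪q⁻ D side)
    ; far = near ; far∉side = λ near∈rest → rest∌ near∈rest (inj₂ near∈side)
    ; far∉D = disjoint near∈side }
    where
    open Separation σ
    rest∌ : ∀ {v} → v ∈ ∁ (D ∪ side) → ¬ (v ∈ D ⊎ v ∈ side)
    rest∌ v∈rest = x∈∁p⇒x∉p v∈rest ∘ x∈p∪q⁺

  componentSeparation : ∀ {D} (σ : Separation D) →
                        Component (Separation.side σ) (Separation.near σ) → Separation D
  componentSeparation {D} σ K = record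
    { side = members ; separated = separated′ ; disjoint = disjoint ∘ ⊆X
    ; near = near ; near∈side = root ; far = far ; far∉side = far∉side ∘ ⊆X ; far∉D = far∉D }
    where
    open Separation σ
    open Component K
    separated′ : SeparatedBy D members
    separated′ {u} {w} u∈K w∉K w∉D with w ∈? side
    ... | yes w∈side = ¬adjacent⇒stronglyAntiAdjacent (w∉K ∘ closed u∈K w∈side)
    ... | no w∉side  = separated (⊆X u∈K) w∉side w∉D

  Attached : Subset n → Fin n → Set
  Attached S c = ∃[ s ] s ∈ S × Adjacent G c s

  attached? : ∀ S c → Dec (Attached S c)
  attached? S c = Fin.any? λ s → (s ∈? S) ×-dec adjacent? c s

  pathThrough : ∀ {X y D a b} {Q : Fin n → Set} (K : Component X y) →
                (∀ {w} → w ∈ Component.members K → Q w) →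
                a ∈ D → b ∈ D → Attached (Component.members K) a → Attached (Component.members K) b →
                InducedPathWithin (λ w → w ∈ D ⊎ Q w) a b
  pathThrough K K⊆Q a∈D b∈D (s , s∈K , a~s) (t , t∈K , b~t) = walk⇒inducedPath (inj₁ a∈D)
    ( (inj₁ a∈D , a~s , inj₂ (K⊆Q s∈K))
    ◅ walkWithin-mono (inj₂ ∘ K⊆Q) (Component.connecting K s∈K t∈K)
    ◅◅ (inj₂ (K⊆Q t∈K) , adjacent-sym b~t , inj₁ b∈D)
    ◅ ε )

  clique-separation⇒good : ISK4WheelFree G → ∀ {D} → StrongClique G D → Separation D →
                           GoodCutPartition G
  clique-separation⇒good free clique σ =
    labelling , isCutPartition ,
    inj₁ ((clique′ , cutPartition⇒disconnected isCutPartition) , strongClique⇒∣∣≤3 free clique′)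
    where
    open Separation σ
    clique′ : StrongClique G (partSet G labelling inC)
    clique′ = subst (StrongClique G) (sym labelledC≡D) clique

  stable-separation⇒good : ∀ {D a b} → Stable2Cutset G D → (σ : Separation D) →
    a ∈ D → b ∈ D → a ≢ b →
    InducedPathWithin (λ w → w ∈ D ⊎ w ∈ Separation.side σ) a b →
    InducedPathWithin (λ w → w ∈ D ⊎ w ∉ Separation.side σ) a b → GoodCutPartition G
  stable-separation⇒good {D} cutset σ a∈D b∈D a≢b throughSide throughRest =
    labelling , isCutPartition ,
    inj₂ ( subst (Stable2Cutset G) (sym labelledC≡D) cutset
         , _ , _ , labelledC a∈D , labelledC b∈D , a≢b
         , inducedPath⇒narrow notB throughSide
         , inducedPath⇒narrow notA throughRest )
    where
    open Separation σ
    labelledC : ∀ {v} → v ∈ D → v ∈ partSet G labelling inC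
    labelledC = subst (_ ∈_) (sym labelledC≡D)
    notB : ∀ {w} → w ∈ D ⊎ w ∈ side → w ∈ ∁ (partSet G labelling inB)
    notB {w} w∈D∪side = x∉p⇒x∈∁p λ w∈B →
      let (w∉D , w∉side) = classify≡inB (w ∈? D) _ (∈-partSet⁻ w∈B)
      in  [ w∉D , w∉side ] w∈D∪side
    notA : ∀ {w} → w ∈ D ⊎ w ∉ side → w ∈ ∁ (partSet G labelling inA)
    notA {w} w∈D∪rest = x∉p⇒x∈∁p λ w∈A →
      let (w∉D , w∈side) = classify≡inA (w ∈? D) _ (∈-partSet⁻ w∈A)
      in  [ w∉D , (λ w∉side → w∉side w∈side) ] w∈D∪rest

  unattached⇒good : ISK4WheelFree G → ∀ {C c c′} (σ : Separation C) → c ∈ C → c′ ∈ C → c′ ≢ c →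
                    (∀ {w} → w ∈ C → w ≡ c ⊎ w ≡ c′) → ¬ Attached (Separation.side σ) c′ →
                    GoodCutPartition G
  unattached⇒good free {C} {c} {c′} σ c∈C c′∈C c′≢c C⊆cc′ ¬attached =
    clique-separation⇒good free singleton-clique record
      { side = side ; separated = separated′
      ; disjoint = λ v∈side v∈⁅c⁆ → disjoint v∈side (subst (_∈ C) (sym (x∈⁅y⁆⇒x≡y c v∈⁅c⁆)) c∈C)
      ; near = near ; near∈side = near∈side
      ; far = c′ ; far∉side = λ c′∈side → disjoint c′∈side c′∈C ; far∉D = x≢y⇒x∉⁅y⁆ c′≢c }
    where
    open Separation σ
    singleton-clique : StrongClique G ⁅ c ⁆
    singleton-clique u v u∈⁅c⁆ v∈⁅c⁆ u≢v =
      ⊥-elim (u≢v (trans (x∈⁅y⁆⇒x≡y c u∈⁅c⁆) (sym (x∈⁅y⁆⇒x≡y c v∈⁅c⁆))))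
    separated′ : SeparatedBy ⁅ c ⁆ side
    separated′ {u} {w} u∈side w∉side w∉⁅c⁆ with w ∈? C
    ... | no w∉C  = separated u∈side w∉side w∉C
    ... | yes w∈C with C⊆cc′ w∈C
    ...   | inj₁ refl = ⊥-elim (w∉⁅c⁆ (x∈⁅x⁆ c))
    ...   | inj₂ refl =
      ¬adjacent⇒stronglyAntiAdjacent λ u~w → ¬attached (u , u∈side , adjacent-sym u~w)

  attachedOrGood : ISK4WheelFree G → ∀ {C a b} (σ : Separation C) → a ∈ C → b ∈ C → b ≢ a →
                   (∀ {w} → w ∈ C → w ≡ a ⊎ w ≡ b) →
                   (Attached (Separation.side σ) a × Attached (Separation.side σ) b) ⊎ GoodCutPartition G
  attachedOrGood free {a = a} {b} σ a∈C b∈C b≢a C⊆ab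
    with attached? (Separation.side σ) a | attached? (Separation.side σ) b
  ... | yes a~S | yes b~S = inj₁ (a~S , b~S)
  ... | no ¬a~S | _       = inj₂ (unattached⇒good free σ b∈C a∈C (b≢a ∘ sym) (Sum.swap ∘ C⊆ab) ¬a~S)
  ... | yes _   | no ¬b~S = inj₂ (unattached⇒good free σ a∈C b∈C b≢a C⊆ab ¬b~S)

  cliqueCutset⇒good : ISK4WheelFree G → ∀ {C} → CliqueCutset G C → GoodCutPartition G
  cliqueCutset⇒good free (clique , disconnected) =
    clique-separation⇒good free clique (disconnected⇒separation disconnected)

  stable2Cutset⇒good : ISK4WheelFree G → ∀ {C} → Stable2Cutset G C → GoodCutPartition G
  stable2Cutset⇒good free {C} cutset@(_ , size , disconnected) with ∣p∣≡2⇒pair size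
  ... | a , b , a∈C , b∈C , b≢a , C⊆ab =
    finish (attachedOrGood free σS a∈C b∈C b≢a C⊆ab) (attachedOrGood free σT a∈C b∈C b≢a C⊆ab)
    where
    open Separation using (side; near; near∈side)
    σ : Separation C
    σ = disconnected⇒separation disconnected
    KS : Component (side σ) (near σ)
    KS = component _ (near∈side σ)
    σS : Separation C
    σS = componentSeparation σ KS
    KT : Component (side (opposite σS)) (near (opposite σS))
    KT = component _ (near∈side (opposite σS))
    σT : Separation C
    σT = componentSeparation (opposite σS) KT
    T∩S≡∅ : ∀ {w} → w ∈ side σT → w ∉ side σS
    T∩S≡∅ w∈T w∈S = x∈∁p⇒x∉p (Component.⊆X KT w∈T) (x∈p∪q⁺ (inj₂ w∈S))

    finish : (Attached (side σS) a × Attached (side σS) b) ⊎ GoodCutPartition G →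
             (Attached (side σT) a × Attached (side σT) b) ⊎ GoodCutPartition G →
             GoodCutPartition G
    finish (inj₂ good)        _                  = good
    finish (inj₁ _)           (inj₂ good)        = good
    finish (inj₁ (a~S , b~S)) (inj₁ (a~T , b~T)) =
      stable-separation⇒good cutset σS a∈C b∈C (b≢a ∘ sym)
        (pathThrough KS id a∈C b∈C a~S b~S) (pathThrough KT T∩S≡∅ a∈C b∈C a~T b~T)

proposition4p2 : ∀ {n : ℕ} (G : Trigraph n) → ISK4WheelFree G →
    (((∃[ C ] CliqueCutset G C) ⊎ (∃[ C ] Stable2Cutset G C)) → GoodCutPartition G)
    × (GoodCutPartition G → ((∃[ C ] CliqueCutset G C) ⊎ (∃[ C ] Stable2Cutset G C)))
proposition4p2 G free = cutset⇒good , good⇒cutset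
  where
  cutset⇒good : (∃[ C ] CliqueCutset G C) ⊎ (∃[ C ] Stable2Cutset G C) → GoodCutPartition G
  cutset⇒good (inj₁ (_ , cutset)) = cliqueCutset⇒good G free cutset
  cutset⇒good (inj₂ (_ , cutset)) = stable2Cutset⇒good G free cutset
  good⇒cutset : GoodCutPartition G → (∃[ C ] CliqueCutset G C) ⊎ (∃[ C ] Stable2Cutset G C)
  good⇒cutset (_ , _ , inj₁ (cutset , _)) = inj₁ (_ , cutset)
  good⇒cutset (_ , _ , inj₂ (cutset , _)) = inj₂ (_ , cutset)
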